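{- Let $S=(1,2,2,2,\ldots)$, i.e. $a_1=1$ and $a_i=2$ for all $i\ge 2$. Then $\chi_S(G_3)=6$.
   Context: $G_3$ denotes the integer distance graph $G(\mathbb{Z},\{2,3\})$: its vertex set is $\mathbb{Z}$, and distinct $i,j\in\mathbb{Z}$ are adjacent if and only if $|i-j|\in\{2,3\}$. For a graph $G$ and a non-decreasing sequence $S=(a_1,a_2,\ldots)$ of positive integers, an $S$-packing $k$-coloring of $G$ is a map $f:V(G)\to\{1,\ldots,k\}$ such that any two distinct vertices $u,v$ with $f(u)=f(v)=i$ satisfy $d_G(u,v)>a_i$, where $d_G$ is the shortest-path distance. The $S$-packing chromatic number $\chi_S(G)$ is the smallest $k$ for which $G$ has an $S$-packing $k$-coloring. -}

module Defs where

open import Data.Nat using (ℕ; zero; suc; _≤_)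
open import Data.Integer using (ℤ; ∣_∣; _-_)
open import Data.Fin using (Fin; toℕ)
open import Data.Sum using (_⊎_)
open import Data.Product using (Σ; _×_; ∃-syntax)
open import Relation.Binary.PropositionalEquality using (_≡_; _≢_)
open import Relation.Nullary using (¬_)

Adj : ℤ → ℤ → Set
Adj i j = (∣ i - j ∣ ≡ 2) ⊎ (∣ i - j ∣ ≡ 3)

data Walk : ℤ → ℤ → ℕ → Set where
  here : ∀ {u} → Walk u u 0
  step : ∀ {u v w n} → Adj u v → Walk v w n → Walk u w (suc n)

-- Shortest-path distance d(u,v) ≤ a  iff  there is a walk of length ≤ a.
DistLe : ℤ → ℤ → ℕ → Set
DistLe u v a = ∃[ n ] (n ≤ a × Walk u v n)

-- The sequence S = (1,2,2,2,...), indexed from 1 (index 0 is unused).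
S : ℕ → ℕ
S 0 = 1
S 1 = 1
S (suc (suc _)) = 2

-- An S-packing k-coloring of G_3 for a sequence a (colors 1..k are Fin k,
-- color c standing for c+1, whose bound is a (c+1)):
-- same-colored distinct vertices must have distance > a_i.
IsPackingColoring : (ℕ → ℕ) → (k : ℕ) → (ℤ → Fin k) → Set
IsPackingColoring a k f =
  ∀ u v → u ≢ v → f u ≡ f v → ¬ DistLe u v (a (suc (toℕ (f u))))

HasPackingColoring : (ℕ → ℕ) → ℕ → Set
HasPackingColoring a k = Σ (ℤ → Fin k) (IsPackingColoring a k)

PackingChromaticNumberIs : (ℕ → ℕ) → ℕ → Set
PackingChromaticNumberIs a k =
  HasPackingColoring a k × (∀ m → HasPackingColoring a m → k ≤ m)

-- Six colours suffice: colour u by its residue mod 7, residues 0 and 1 sharing the colour of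
-- bound 1 and every other residue getting a colour of its own. A walk of length at most 2
-- moves by at most 6, so distinct vertices with equal residues are at distance > 2, and two
-- vertices with residues in {0, 1} never differ by 2 or 3.
-- Five colours do not suffice: two vertices at gap d ≤ 6 are at distance ≤ 2, and at
-- distance 1 when d ∈ {2, 3}, so the colours of 0, 1, 2, … are locally constrained, and an
-- exhaustive search shows that ten consecutive vertices admit no such 5-colouring.
module Submission where

open import Defs
open import Data.Nat as ℕ using (ℕ; zero; suc; _≤_; _<_; _∸_; z≤n; s≤s; NonZero)
import Data.Nat.Properties as ℕ
open import Data.Integer as ℤ using (ℤ; +_; -[1+_]; ∣_∣; _-_; _%ℕ_; _/ℕ_; 0ℤ)
import Data.Integer.Properties as ℤ
open import Data.Integer.DivMod using (a≡a%ℕn+[a/ℕn]*n; n%ℕd<d)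
open import Data.Integer.Tactic.RingSolver using (solve-∀)
open import Data.Fin as Fin using (Fin; toℕ; fromℕ<; inject≤)
import Data.Fin.Properties as Fin
open import Data.List using (List; []; _∷_; allFin)
open import Data.List.Relation.Unary.All as All using (All; all?)
open import Data.List.Membership.Propositional.Properties using (∈-allFin)
open import Data.Unit using (⊤; tt)
open import Data.Empty using (⊥; ⊥-elim)
open import Data.Sum using (_⊎_; inj₁; inj₂)
open import Data.Product using (_×_; _,_)
open import Function using (_∘_)
open import Relation.Nullary using (¬_; Dec; yes; no)
open import Relation.Nullary.Decidable using (_×-dec_; _⊎-dec_; _→-dec_; ¬?; from-yes)
open import Relation.Binary.PropositionalEquality

IsStep : ℤ → Set
IsStep j = ∣ j ∣ ≡ 2 ⊎ ∣ j ∣ ≡ 3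

adj-+ : ∀ i {j} → IsStep j → Adj i (i ℤ.+ j)
adj-+ i {j} = subst (λ n → n ≡ 2 ⊎ n ≡ 3) (sym ∣i-[i+j]∣≡∣j∣)
  where
  i-[i+j]≡-j : ∀ i j → i - (i ℤ.+ j) ≡ ℤ.- j
  i-[i+j]≡-j = solve-∀
  ∣i-[i+j]∣≡∣j∣ : ∣ i - (i ℤ.+ j) ∣ ≡ ∣ j ∣
  ∣i-[i+j]∣≡∣j∣ = trans (cong ∣_∣ (i-[i+j]≡-j i j)) (ℤ.∣-i∣≡∣i∣ j)

walk₁ : ∀ i {j} → IsStep j → Walk i (i ℤ.+ j) 1
walk₁ i step-j = step (adj-+ i step-j) here

walk₂ : ∀ i {j k} → IsStep j → IsStep k → Walk i (i ℤ.+ (j ℤ.+ k)) 2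
walk₂ i {j} {k} step-j step-k =
  subst (λ w → Walk i w 2) (ℤ.+-assoc i j k) (step (adj-+ i step-j) (walk₁ (i ℤ.+ j) step-k))

adj⇒2≤∣u-v∣ : ∀ {u v} → Adj u v → 2 ≤ ∣ u - v ∣
adj⇒2≤∣u-v∣ (inj₁ ∣u-v∣≡2) = ℕ.≤-reflexive (sym ∣u-v∣≡2)
adj⇒2≤∣u-v∣ (inj₂ ∣u-v∣≡3) = ℕ.≤-trans (ℕ.n≤1+n 2) (ℕ.≤-reflexive (sym ∣u-v∣≡3))

adj⇒∣u-v∣≤3 : ∀ {u v} → Adj u v → ∣ u - v ∣ ≤ 3
adj⇒∣u-v∣≤3 (inj₁ ∣u-v∣≡2) = ℕ.≤-trans (ℕ.≤-reflexive ∣u-v∣≡2) (ℕ.n≤1+n 2)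
adj⇒∣u-v∣≤3 (inj₂ ∣u-v∣≡3) = ℕ.≤-reflexive ∣u-v∣≡3

walk⇒∣u-v∣≤3n : ∀ {u v n} → Walk u v n → ∣ u - v ∣ ≤ 3 ℕ.* n
walk⇒∣u-v∣≤3n {u} here = ℕ.≤-reflexive (cong ∣_∣ (ℤ.+-inverseʳ u))
walk⇒∣u-v∣≤3n {u} {w} (step {v = v} {n = n} adj walk) = begin
  ∣ u - w ∣                ≡⟨ cong ∣_∣ (split u v w) ⟩
  ∣ (u - v) ℤ.+ (v - w) ∣  ≤⟨ ℤ.∣i+j∣≤∣i∣+∣j∣ (u - v) (v - w) ⟩
  ∣ u - v ∣ ℕ.+ ∣ v - w ∣  ≤⟨ ℕ.+-mono-≤ (adj⇒∣u-v∣≤3 {u} {v} adj) (walk⇒∣u-v∣≤3n walk) ⟩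
  3 ℕ.+ 3 ℕ.* n            ≡⟨ ℕ.*-suc 3 n ⟨
  3 ℕ.* suc n              ∎
  where
  open ℕ.≤-Reasoning
  split : ∀ u v w → u - w ≡ (u - v) ℤ.+ (v - w)
  split = solve-∀

distLe⇒∣u-v∣≤3a : ∀ {u v a} → DistLe u v a → ∣ u - v ∣ ≤ 3 ℕ.* a
distLe⇒∣u-v∣≤3a (n , n≤a , walk) = ℕ.≤-trans (walk⇒∣u-v∣≤3n walk) (ℕ.*-monoʳ-≤ 3 n≤a)

distLe-1⇒≡⊎adj : ∀ {u v} → DistLe u v 1 → u ≡ v ⊎ Adj u v
distLe-1⇒≡⊎adj (zero         , _      , here)          = inj₁ refl
distLe-1⇒≡⊎adj (suc zero     , _      , step adj here) = inj₂ adj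
distLe-1⇒≡⊎adj (suc (suc _)  , s≤s () , _)

multiple<divisor⇒0 : ∀ q d → ∣ q ℤ.* + d ∣ < d → q ≡ 0ℤ
multiple<divisor⇒0 q d small = ℤ.∣i∣≡0⇒i≡0 (ℕ.n<1⇒n≡0 (ℕ.*-cancelʳ-< d ∣ q ∣ 1 ∣q∣d<1d))
  where
  ∣q∣d<1d : ∣ q ∣ ℕ.* d < 1 ℕ.* d
  ∣q∣d<1d = subst₂ _<_ (ℤ.abs-* q (+ d)) (sym (ℕ.*-identityˡ d)) small

-- The two differences agree up to a multiple of d, which vanishes when it is smaller than d.
%ℕ-rigid : ∀ i j d .{{_ : NonZero d}} →
           ∣ (i - j) - (+ (i %ℕ d) - + (j %ℕ d)) ∣ < d → i - j ≡ + (i %ℕ d) - + (j %ℕ d)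
%ℕ-rigid i j d small = ℤ.i-j≡0⇒i≡j _ _ (trans difference (cong (ℤ._* + d) q≡0))
  where
  q : ℤ
  q = i /ℕ d - j /ℕ d
  cancel : ∀ r s a b e → ((r ℤ.+ a ℤ.* e) - (s ℤ.+ b ℤ.* e)) - (r - s) ≡ (a - b) ℤ.* e
  cancel = solve-∀
  difference : (i - j) - (+ (i %ℕ d) - + (j %ℕ d)) ≡ q ℤ.* + d
  difference = trans (cong₂ (λ x y → (x - y) - (+ (i %ℕ d) - + (j %ℕ d)))
                            (a≡a%ℕn+[a/ℕn]*n i d) (a≡a%ℕn+[a/ℕn]*n j d))
                     (cancel (+ (i %ℕ d)) (+ (j %ℕ d)) (i /ℕ d) (j /ℕ d) (+ d))
  q≡0 : q ≡ 0ℤ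
  q≡0 = multiple<divisor⇒0 q d (subst (λ x → ∣ x ∣ < d) difference small)

residue : ℤ → ℕ
residue u = u %ℕ 7

equal-residues-close⇒≡ : ∀ {u v} → residue u ≡ residue v → ∣ u - v ∣ ≤ 6 → u ≡ v
equal-residues-close⇒≡ {u} {v} same close = ℤ.i-j≡0⇒i≡j u v (trans u-v≡e e≡0)
  where
  e : ℤ
  e = + residue u - + residue v
  e≡0 : e ≡ 0ℤ
  e≡0 = ℤ.i≡j⇒i-j≡0 (cong +_ same)
  [u-v]-e≡u-v : (u - v) - e ≡ u - v
  [u-v]-e≡u-v = trans (cong ((u - v) -_) e≡0) (ℤ.+-identityʳ (u - v))
  u-v≡e : u - v ≡ e
  u-v≡e = %ℕ-rigid u v 7 (subst (λ x → ∣ x ∣ < 7) (sym [u-v]-e≡u-v) (s≤s close))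

small-residues⇒¬adj : ∀ {u v} → residue u ≤ 1 → residue v ≤ 1 → ¬ Adj u v
small-residues⇒¬adj {u} {v} ru≤1 rv≤1 adj =
  ℕ.<⇒≱ (ℕ.≤-trans (s≤s ∣e∣≤1) (adj⇒2≤∣u-v∣ {u} {v} adj)) (ℕ.≤-reflexive (cong ∣_∣ u-v≡e))
  where
  e : ℤ
  e = + residue u - + residue v
  ∣e∣≤1 : ∣ e ∣ ≤ 1
  ∣e∣≤1 = subst (_≤ 1) (sym (cong ∣_∣ (ℤ.m-n≡m⊖n (residue u) (residue v))))
            (ℕ.≤-trans (ℤ.∣m⊝n∣≤m⊔n (residue u) (residue v)) (ℕ.⊔-lub ru≤1 rv≤1))
  ∣[u-v]-e∣≤4 : ∣ (u - v) - e ∣ ≤ 4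
  ∣[u-v]-e∣≤4 = ℕ.≤-trans (ℤ.∣i-j∣≤∣i∣+∣j∣ (u - v) e)
                          (ℕ.+-mono-≤ (adj⇒∣u-v∣≤3 {u} {v} adj) ∣e∣≤1)
  u-v≡e : u - v ≡ e
  u-v≡e = %ℕ-rigid u v 7 (ℕ.≤-<-trans ∣[u-v]-e∣≤4 (from-yes (4 ℕ.<? 7)))

-- Colour index residue u ∸ 1: residues 0 and 1 share index 0 (the colour with bound 1).
colouring : ℤ → Fin 6
colouring u = fromℕ< (s≤s (ℕ.∸-monoˡ-≤ 1 (ℕ.s≤s⁻¹ (n%ℕd<d u 7))))

toℕ-colouring : ∀ u → toℕ (colouring u) ≡ residue u ∸ 1
toℕ-colouring u = Fin.toℕ-fromℕ< _

colouring-valid : IsPackingColoring S 6 colouring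
colouring-valid u v u≢v same rewrite toℕ-colouring u = apart (residue u ∸ 1) refl
  where
  same-index : residue u ∸ 1 ≡ residue v ∸ 1
  same-index = trans (sym (toℕ-colouring u)) (trans (cong toℕ same) (toℕ-colouring v))
  positive : ∀ {r k} → r ∸ 1 ≡ suc k → 1 ≤ r
  positive {suc _} _ = s≤s z≤n
  apart : ∀ k → residue u ∸ 1 ≡ k → ¬ DistLe u v (S (suc k))
  apart zero index≡0 close with distLe-1⇒≡⊎adj close
  ... | inj₁ u≡v = u≢v u≡v
  ... | inj₂ adj = small-residues⇒¬adj {u} {v} (ℕ.m∸n≡0⇒m≤n index≡0)
                     (ℕ.m∸n≡0⇒m≤n (trans (sym same-index) index≡0)) adj
  apart (suc k) index≡1+k =
    u≢v ∘ equal-residues-close⇒≡ {u} {v} same-residue ∘ distLe⇒∣u-v∣≤3a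
    where
    same-residue : residue u ≡ residue v
    same-residue = ℕ.∸-cancelʳ-≡ (positive index≡1+k)
                     (positive (trans (sym same-index) index≡1+k)) same-index

TooClose : ∀ {k} → Fin k → ℕ → Set
TooClose Fin.zero    d = d ≡ 2 ⊎ d ≡ 3
TooClose (Fin.suc _) d = 1 ≤ d × d ≤ 6

tooClose? : ∀ {k} (c : Fin k) d → Dec (TooClose c d)
tooClose? Fin.zero    d = (d ℕ.≟ 2) ⊎-dec (d ℕ.≟ 3)
tooClose? (Fin.suc _) d = (1 ℕ.≤? d) ×-dec (d ℕ.≤? 6)

tooClose⇒distLe : ∀ {k} (c : Fin k) {d} u → TooClose c d → DistLe u (u ℤ.+ + d) (S (suc (toℕ c)))
tooClose⇒distLe Fin.zero        u (inj₁ refl) = 1 , ℕ.≤-refl , walk₁ u (inj₁ refl)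
tooClose⇒distLe Fin.zero        u (inj₂ refl) = 1 , ℕ.≤-refl , walk₁ u (inj₂ refl)
tooClose⇒distLe (Fin.suc _) {0} u (() , _)
tooClose⇒distLe (Fin.suc _) {1} u _ = 2 , ℕ.≤-refl , walk₂ u {+ 3} { -[1+ 1 ] } (inj₂ refl) (inj₁ refl)
tooClose⇒distLe (Fin.suc _) {2} u _ = 1 , s≤s z≤n , walk₁ u {+ 2} (inj₁ refl)
tooClose⇒distLe (Fin.suc _) {3} u _ = 1 , s≤s z≤n , walk₁ u {+ 3} (inj₂ refl)
tooClose⇒distLe (Fin.suc _) {4} u _ = 2 , ℕ.≤-refl , walk₂ u {+ 2} {+ 2} (inj₁ refl) (inj₁ refl)
tooClose⇒distLe (Fin.suc _) {5} u _ = 2 , ℕ.≤-refl , walk₂ u {+ 2} {+ 3} (inj₁ refl) (inj₂ refl)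
tooClose⇒distLe (Fin.suc _) {6} u _ = 2 , ℕ.≤-refl , walk₂ u {+ 3} {+ 3} (inj₂ refl) (inj₂ refl)
tooClose⇒distLe (Fin.suc _) {suc (suc (suc (suc (suc (suc (suc _))))))} u
  (_ , s≤s (s≤s (s≤s (s≤s (s≤s (s≤s ()))))))

-- cs lists the colours of the preceding vertices, nearest first, the first one at gap d.
Fits : ∀ {k} → ℕ → Fin k → List (Fin k) → Set
Fits d c []        = ⊤
Fits d c (c′ ∷ cs) = (c ≡ c′ → ¬ TooClose c d) × Fits (suc d) c cs

fits? : ∀ {k} d (c : Fin k) cs → Dec (Fits d c cs)
fits? d c []        = yes tt
fits? d c (c′ ∷ cs) = ((c Fin.≟ c′) →-dec ¬? (tooClose? c d)) ×-dec fits? (suc d) c cs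

Unextendable : ∀ {k} → ℕ → List (Fin k) → Set
Unextendable     zero    cs = ⊥
Unextendable {k} (suc n) cs = All (λ c → Fits 1 c cs → Unextendable n (c ∷ cs)) (allFin k)

unextendable? : ∀ {k} n (cs : List (Fin k)) → Dec (Unextendable n cs)
unextendable?     zero    cs = no λ ()
unextendable? {k} (suc n) cs = all? (λ c → fits? 1 c cs →-dec unextendable? n (c ∷ cs)) (allFin k)

module _ {k} {g : ℤ → Fin k} (valid : IsPackingColoring S k g) where

  history : ℕ → List (Fin k)
  history zero    = []
  history (suc m) = g (+ m) ∷ history m

  fits-history : ∀ m d → Fits (suc d) (g (+ (m ℕ.+ d))) (history m)
  fits-history zero    d = tt
  fits-history (suc m) d rewrite sym (ℕ.+-suc m d) = clash-free , fits-history m (suc d)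
    where
    c : Fin k
    c = g (+ (m ℕ.+ suc d))
    clash-free : c ≡ g (+ m) → ¬ TooClose c (suc d)
    clash-free same close =
      valid (+ m) (+ (m ℕ.+ suc d)) (ℕ.<⇒≢ (ℕ.m<m+n m (s≤s z≤n)) ∘ ℤ.+-injective) (sym same)
            (tooClose⇒distLe (g (+ m)) (+ m) (subst (λ c′ → TooClose c′ (suc d)) same close))

  history-extendable : ∀ n m → ¬ Unextendable n (history m)
  history-extendable (suc n) m unextendable =
    history-extendable n (suc m) (All.lookup unextendable (∈-allFin (g (+ m))) fits)
    where
    fits : Fits 1 (g (+ m)) (history m)
    fits = subst (λ p → Fits 1 (g (+ p)) (history m)) (ℕ.+-identityʳ m) (fits-history m 0)

no-5-colouring : ¬ HasPackingColoring S 5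
no-5-colouring (g , valid) = history-extendable valid 10 0 (from-yes (unextendable? {5} 10 []))

hasPackingColoring-mono : ∀ a {m n} → m ≤ n → HasPackingColoring a m → HasPackingColoring a n
hasPackingColoring-mono a m≤n (f , valid) = (λ u → inject≤ (f u) m≤n) , valid′
  where
  valid′ : IsPackingColoring a _ (λ u → inject≤ (f u) m≤n)
  valid′ u v u≢v same =
    subst (λ k → ¬ DistLe u v (a (suc k))) (sym (Fin.toℕ-inject≤ (f u) m≤n))
          (valid u v u≢v (Fin.inject≤-injective m≤n m≤n (f u) (f v) same))

theorem3 : PackingChromaticNumberIs S 6
theorem3 = (colouring , colouring-valid) , at-least-6
  where
  at-least-6 : ∀ m → HasPackingColoring S m → 6 ≤ m
  at-least-6 m coloured with m ℕ.≤? 5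
  ... | yes m≤5 = ⊥-elim (no-5-colouring (hasPackingColoring-mono S m≤5 coloured))
  ... | no  m≰5 = ℕ.≰⇒> m≰5
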